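{- For any two vectors $\vec k_1=(a_1,a_2,\dots,a_\ell,b)$ and $\vec k_2=(a_1,a_2,\dots,a_\ell,c)$ with positive integers $a_1,\dots,a_\ell,b,c$, one has $\widetilde{C}_{\vec k_1}(q,t)=\widetilde{C}_{\vec k_2}(q,t)$, where $\widetilde{C}_{\vec{k}}(q,t)=\sum_{\pi\in\mathcal{D}_{\vec k}}q^{\mathrm{area}(\pi)}t^{\mathrm{depth}(\pi)}$.
   Context: For a vector $\vec{k}=(k_1,\dots,k_m)$ of positive integers, $N=|\vec k|+m$. A $\vec{k}$-Dyck path is a word $\pi=\pi_1\cdots\pi_N$ consisting of the letters $S^{k_1},\dots,S^{k_m}$, each exactly once and in this order from left to right, together with $|\vec k|$ letters $W$, such that the starting ranks $r_1=0$, $r_{i+1}=r_i+k_j$ if $\pi_i=S^{k_j}$, $r_{i+1}=r_i-1$ if $\pi_i=W$, are all nonnegative. $\mathcal{D}_{\vec k}$ is the set of $\vec k$-Dyck paths. The area sequence is $(a_1,\dots,a_m)$ with $a_j=r_i$ where $\pi_i=S^{k_j}$; $\mathrm{area}(\pi)=\sum_j a_j$. Filling algorithm $\eta_*$: in a tableau of $m$ top-justified columns, column $i$ with $k_i+1$ cells, place $1,\dots,N$ successively: $1$ at the top of column 1; for $i\ge2$, if $\pi_i$ is an $S$-letter put $i$ at the top of the leftmost empty column, and if $\pi_i=W$ put $i$ immediately below the largest active entry (an entry is active if it is currently the bottom-most entry of its column $j$ and that column has fewer than $k_j+1$ entries). Ranking: column 1 gets ranks $0,1,\dots,k_1$ top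 to bottom; for $i\ge2$, if the top entry of column $i$ is $A+1$ and $A$ has rank $\alpha$, column $i$ gets ranks $\alpha,\dots,\alpha+k_i$ top to bottom. $\mathrm{depth}(\pi)$ is the sum of the ranks of the first-row cells of $\eta_*(\pi)$. -}

module Defs where

open import Data.Bool using (Bool; true; false; if_then_else_)
open import Data.Nat using (ℕ; zero; suc; _+_; _∸_; _<ᵇ_; _≡ᵇ_)
open import Data.Nat.Properties using () renaming (_≟_ to _≟ℕ_)
open import Data.Integer using (ℤ; +_; _-_; _≤_; 0ℤ) renaming (_+_ to _+ℤ_)
open import Data.Integer.Properties using () renaming (_≟_ to _≟ℤ_; _≤?_ to _≤ℤ?_)
open import Data.List using (List; []; _∷_; _++_; length; filter; map; [_])
open import Data.Nat.ListAction using (sum)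
open import Data.List.Relation.Unary.All using (All; all?)
open import Data.Maybe using (Maybe; just; nothing)
open import Data.Product using (_×_; _,_)
open import Relation.Nullary.Decidable using (Dec; _×-dec_)
open import Relation.Unary using (Decidable)

-- A vector k⃗ = (k₁,…,kₘ) is a List ℕ (entries assumed positive
-- where needed).  A word uses the letters S^{k₁},…,S^{kₘ} each exactly
-- once and in this order, so the j-th S-letter of the word is S^{kⱼ};
-- we therefore record only whether a letter is an S-letter or W.

data Letter : Set where
  S W : Letter

∣_∣v : List ℕ → ℕ
∣ k ∣v = sum k

lenN : List ℕ → ℕ
lenN k = ∣ k ∣v + length k

countS : List Letter → ℕ
countS []       = 0
countS (S ∷ w)  = suc (countS w)
countS (W ∷ w)  = countS w

countW : List Letter → ℕ
countW []       = 0
countW (S ∷ w)  = countW w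
countW (W ∷ w)  = suc (countW w)

ranksFrom : List ℕ → ℤ → List Letter → List ℤ
ranksFrom ks       r []        = []
ranksFrom []       r (S ∷ w)   = r ∷ ranksFrom [] r w          -- (never for valid words)
ranksFrom (kj ∷ ks) r (S ∷ w)  = r ∷ ranksFrom ks (r +ℤ + kj) w
ranksFrom ks       r (W ∷ w)   = r ∷ ranksFrom ks (r - + 1) w

startRanks : List ℕ → List Letter → List ℤ
startRanks k w = ranksFrom k 0ℤ w

IsKDyck : List ℕ → List Letter → Set
IsKDyck k w = (countS w ≡ length k) × (countW w ≡ ∣ k ∣v)
              × All (λ r → 0ℤ ≤ r) (startRanks k w)
  where open import Relation.Binary.PropositionalEquality using (_≡_)

isKDyck? : (k : List ℕ) → Decidable (IsKDyck k)
isKDyck? k w = (countS w ≟ℕ length k) ×-dec ((countW w ≟ℕ ∣ k ∣v)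
               ×-dec all? (λ r → 0ℤ ≤ℤ? r) (startRanks k w))

words : ℕ → List (List Letter)
words zero    = [] ∷ []
words (suc n) = map (S ∷_) (words n) ++ map (W ∷_) (words n)

-- 𝒟_{k⃗}: every word of a k⃗-Dyck path has length N, so this lists 𝒟_{k⃗}
dyckPaths : List ℕ → List (List Letter)
dyckPaths k = filter (isKDyck? k) (words (lenN k))

areaFrom : List ℕ → ℤ → List Letter → ℤ
areaFrom ks        r []       = 0ℤ
areaFrom []        r (S ∷ w)  = r +ℤ areaFrom [] r w
areaFrom (kj ∷ ks) r (S ∷ w)  = r +ℤ areaFrom ks (r +ℤ + kj) w
areaFrom ks        r (W ∷ w)  = areaFrom ks (r - + 1) w

area : List ℕ → List Letter → ℤ
area k w = areaFrom k 0ℤ w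

-- Filling algorithm η_*.  A tableau is a list of columns (left to right);
-- a column is (capacity kⱼ+1 , entries top to bottom).

Column : Set
Column = ℕ × List ℕ

placeTop : ℕ → List Column → List Column
placeTop i []                  = []
placeTop i ((c , []) ∷ cols)   = (c , [ i ]) ∷ cols
placeTop i ((c , x ∷ xs) ∷ cols) = (c , x ∷ xs) ∷ placeTop i cols

lastOf : ℕ → List ℕ → ℕ
lastOf d []       = d
lastOf d (x ∷ xs) = lastOf x xs

maxM : Maybe ℕ → Maybe ℕ → Maybe ℕ
maxM nothing  m        = m
maxM (just a) nothing  = just a
maxM (just a) (just b) = just (if a <ᵇ b then b else a)

activeOf : Column → Maybe ℕ
activeOf (c , [])     = nothing
activeOf (c , x ∷ xs) = if length (x ∷ xs) <ᵇ c then just (lastOf x xs) else nothing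

maxActive : List Column → Maybe ℕ
maxActive []           = nothing
maxActive (col ∷ cols) = maxM (activeOf col) (maxActive cols)

putBelow : ℕ → ℕ → List Column → List Column
putBelow e i []                    = []
putBelow e i ((c , []) ∷ cols)     = (c , []) ∷ putBelow e i cols
putBelow e i ((c , x ∷ xs) ∷ cols) =
  if lastOf x xs ≡ᵇ e then (c , (x ∷ xs) ++ [ i ]) ∷ cols
                      else (c , x ∷ xs) ∷ putBelow e i cols

step : ℕ → Letter → List Column → List Column
step i S cols = placeTop i cols
step i W cols with maxActive cols
... | just e  = putBelow e i cols
... | nothing = cols

fillFrom : ℕ → List Letter → List Column → List Column
fillFrom i []      cols = cols
fillFrom i (l ∷ w) cols = fillFrom (suc i) w (step i l cols)

emptyTableau : List ℕ → List Column
emptyTableau k = map (λ kj → (suc kj , [])) k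

fill : List ℕ → List Letter → List Column
fill k []      = placeTop 1 (emptyTableau k)
fill k (_ ∷ w) = fillFrom 2 w (placeTop 1 (emptyTableau k))

-- Ranking.  Columns are ranked left to right; acc holds (entry , rank)
-- for all cells of the columns ranked so far.

lookupRank : ℕ → List (ℕ × ℕ) → ℕ
lookupRank a []            = 0
lookupRank a ((e , r) ∷ t) = if e ≡ᵇ a then r else lookupRank a t

rankColumn : ℕ → List ℕ → List (ℕ × ℕ)
rankColumn α []       = []
rankColumn α (x ∷ xs) = (x , α) ∷ rankColumn (suc α) xs

topRank : List (ℕ × ℕ) → List ℕ → ℕ
topRank acc []      = 0
topRank acc (x ∷ _) = lookupRank (x ∸ 1) acc

depthRest : List (ℕ × ℕ) → List Column → ℕ
depthRest acc []              = 0
depthRest acc ((c , xs) ∷ cols) =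
  topRank acc xs + depthRest (acc ++ rankColumn (topRank acc xs) xs) cols

depthTab : List Column → ℕ
depthTab []               = 0
depthTab ((c , xs) ∷ cols) = 0 + depthRest (rankColumn 0 xs) cols

depth : List ℕ → List Letter → ℕ
depth k w = depthTab (fill k w)

-- C̃_{k⃗}(q,t) = Σ_{π ∈ 𝒟_{k⃗}} q^{area π} t^{depth π}, represented by its
-- coefficient function: coefficient of q^i t^j.

Ctilde : List ℕ → ℤ → ℕ → ℕ
Ctilde k i j = length (filter (λ w → (area k w ≟ℤ i) ×-dec (depth k w ≟ℕ j)) (dyckPaths k))

Positive : ℕ → Set
Positive n = 0 Data.Nat.< n

-- After the last S-letter of an (a₁,…,a_ℓ,x)-Dyck path only W's remain, and they must bring the
-- rank h + x reached there back to 0.  So the paths are exactly u S^x W^(h+x), where u ranges over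
-- the prefixes that use S^a₁,…,S^a_ℓ with nonnegative ranks and end at height h, a set that does not
-- depend on x; hence u S^b W^(h+b) ↦ u S^c W^(h+c) is a bijection.  Both paths have area
-- area(u) + h.  For the depth: the rank of a first-row cell with top entry A + 1 is read off the cell
-- of A, and the trailing W's only append entries larger than |u| + 1 below existing entries, so the
-- depth is already fixed by the tableau of u together with the top entry |u| + 1 of the last column.
-- The two counts are compared by walking down the tree of words one letter at a time.

module Submission where

open import Defs
open import Data.Bool using (true; false; if_then_else_)
open import Data.Empty using (⊥-elim)
open import Data.Integer using (ℤ; +_; _-_; 0ℤ; +≤+) renaming (_+_ to _+ℤ_; _≤_ to _≤ℤ_)
import Data.Integer.Properties as ℤ
open import Data.Integer.Properties using () renaming (_≟_ to _≟ℤ_)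
open import Data.Integer.Tactic.RingSolver using () renaming (solve-∀ to ℤ-solve-∀)
open import Data.List using (List; []; _∷_; _++_; [_]; length; filter; map; replicate)
open import Data.List.Properties
  using (++-assoc; ++-identityʳ; map-++; length-++; length-map;
         filter-++; filter-≐; filter-accept; filter-reject; filter-none)
open import Data.List.Relation.Binary.Pointwise as Pointwise using (Pointwise; []; _∷_)
open import Data.List.Relation.Unary.All as All using (All; []; _∷_)
open import Data.List.Relation.Unary.All.Properties using (++⁺; ++⁻ʳ)
open import Data.Maybe using (just; nothing)
open import Data.Nat using (ℕ; zero; suc; _+_; _∸_; _≤_; _<_; z≤n; s≤s; _≡ᵇ_; _≤?_; _≟_)
open import Data.Nat.ListAction using (sum)
open import Data.Nat.ListAction.Properties using (sum-++)
open import Data.Nat.Properties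
  using (+-suc; +-comm; +-identityʳ; +-cancelˡ-≡; +-cancelʳ-≡; suc-injective; 1+n≢0;
         ≤-trans; ≤-reflexive; ≤-pred; m≤m+n; m≤n+m; +-mono-≤; n<1+n; m<n⇒m<1+n; m∸n≤m;
         <⇒≱; <⇒≢; m≤n⇒m<n∨m≡n; module ≤-Reasoning)
open import Data.Nat.Tactic.RingSolver using () renaming (solve-∀ to ℕ-solve-∀)
open import Data.Product using (_×_; _,_; proj₁; proj₂; ∃₂)
open import Data.Sum using (inj₁; inj₂)
open import Function using (_∘_; id; _⇔_; mk⇔; Equivalence)
open import Function.Construct.Composition using (_⇔-∘_)
open import Function.Construct.Symmetry using (⇔-sym)
open import Relation.Binary.PropositionalEquality
  using (_≡_; refl; sym; trans; cong; cong₂; subst; module ≡-Reasoning)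
open import Relation.Nullary using (¬_; yes; no)
open import Relation.Nullary.Decidable using (dec-false; _×-dec_)
open import Relation.Unary using (Pred; Decidable; _∩_)
open import Relation.Unary.Properties using (_∩?_)

-- Filtering and counting words

module _ {a p q} {A : Set a} {P : Pred A p} {Q : Pred A q} (P? : Decidable P) (Q? : Decidable Q) where

  filter-filter : ∀ xs → filter P? (filter Q? xs) ≡ filter (Q? ∩? P?) xs
  filter-filter []       = refl
  filter-filter (x ∷ xs) with Q? x | P? x
  ... | yes qx | yes px = trans (filter-accept P? px) (cong (x ∷_) (filter-filter xs))
  ... | yes qx | no ¬px = trans (filter-reject P? ¬px) (filter-filter xs)
  ... | no _   | _      = filter-filter xs

  length-filter-singleton : ∀ {x y} → P x ⇔ Q y → length (filter P? [ x ]) ≡ length (filter Q? [ y ])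
  length-filter-singleton {x} {y} P⇔Q with P? x | Q? y
  ... | yes _  | yes _  = refl
  ... | no _   | no _   = refl
  ... | yes px | no ¬qy = ⊥-elim (¬qy (Equivalence.to P⇔Q px))
  ... | no ¬px | yes qy = ⊥-elim (¬px (Equivalence.from P⇔Q qy))

module _ {a b p} {A : Set a} {B : Set b} {P : Pred B p} (P? : Decidable P) (f : A → B) where

  filter-map : ∀ xs → filter P? (map f xs) ≡ map f (filter (P? ∘ f) xs)
  filter-map []       = refl
  filter-map (x ∷ xs) with P? (f x)
  ... | yes _ = cong (f x ∷_) (filter-map xs)
  ... | no _  = filter-map xs

countWords : ∀ {p} {P : Pred (List Letter) p} → Decidable P → ℕ → ℕ
countWords P? n = length (filter P? (words n))

module _ {p} {P : Pred (List Letter) p} (P? : Decidable P) where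

  countWords-suc : ∀ n →
    countWords P? (suc n) ≡ countWords (λ v → P? (S ∷ v)) n + countWords (λ v → P? (W ∷ v)) n
  countWords-suc n = begin
    length (filter P? (map (S ∷_) ws ++ map (W ∷_) ws))
      ≡⟨ cong length (filter-++ P? (map (S ∷_) ws) _) ⟩
    length (filter P? (map (S ∷_) ws) ++ filter P? (map (W ∷_) ws))
      ≡⟨ length-++ (filter P? (map (S ∷_) ws)) ⟩
    length (filter P? (map (S ∷_) ws)) + length (filter P? (map (W ∷_) ws))
      ≡⟨ cong₂ _+_ (length-filter-map S) (length-filter-map W) ⟩
    countWords (λ v → P? (S ∷ v)) n + countWords (λ v → P? (W ∷ v)) n ∎
    where
    open ≡-Reasoning
    ws : List (List Letter)
    ws = words n
    length-filter-map : ∀ l → length (filter P? (map (l ∷_) ws)) ≡ countWords (λ v → P? (l ∷ v)) n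
    length-filter-map l = trans (cong length (filter-map P? (l ∷_) ws))
                                (length-map (l ∷_) (filter (λ v → P? (l ∷ v)) ws))

  countWords-none : (∀ v → ¬ P v) → ∀ n → countWords P? n ≡ 0
  countWords-none ¬P n = cong length (filter-none P? (All.universal ¬P (words n)))

  countWords-shift : ∀ u l n →
    countWords (λ v → P? (u ++ l ∷ v)) n ≡ countWords (λ v → P? ((u ++ [ l ]) ++ v)) n
  countWords-shift u l n = cong length (filter-≐ _ _ (to , from) (words n))
    where
    to : ∀ {v} → P (u ++ l ∷ v) → P ((u ++ [ l ]) ++ v)
    to {v} = subst P (sym (++-assoc u [ l ] v))
    from : ∀ {v} → P ((u ++ [ l ]) ++ v) → P (u ++ l ∷ v)
    from {v} = subst P (++-assoc u [ l ] v)

countWords-onlyW : ∀ {p} {P : Pred (List Letter) p} (P? : Decidable P) →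
  (∀ v → P v → countS v ≡ 0) → ∀ n → countWords P? n ≡ length (filter P? [ replicate n W ])
countWords-onlyW P? noS zero    = refl
countWords-onlyW P? noS (suc n) = begin
  countWords P? (suc n)
    ≡⟨ countWords-suc P? n ⟩
  countWords (λ v → P? (S ∷ v)) n + countWords (λ v → P? (W ∷ v)) n
    ≡⟨ cong₂ _+_ (countWords-none _ (λ v → 1+n≢0 ∘ noS (S ∷ v)) n)
                 (countWords-onlyW _ (λ v → noS (W ∷ v)) n) ⟩
  length (filter (λ v → P? (W ∷ v)) [ replicate n W ])
    ≡⟨ length-filter-singleton (λ v → P? (W ∷ v)) P? (mk⇔ id id) ⟩
  length (filter P? [ replicate (suc n) W ]) ∎
  where open ≡-Reasoning

countS-++ : ∀ u v → countS (u ++ v) ≡ countS u + countS v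
countS-++ []      v = refl
countS-++ (S ∷ u) v = cong suc (countS-++ u v)
countS-++ (W ∷ u) v = countS-++ u v

countW-++ : ∀ u v → countW (u ++ v) ≡ countW u + countW v
countW-++ []      v = refl
countW-++ (S ∷ u) v = countW-++ u v
countW-++ (W ∷ u) v = cong suc (countW-++ u v)

length≡countS+countW : ∀ u → length u ≡ countS u + countW u
length≡countS+countW []      = refl
length≡countS+countW (S ∷ u) = cong suc (length≡countS+countW u)
length≡countS+countW (W ∷ u) = trans (cong suc (length≡countS+countW u)) (sym (+-suc _ _))

countS-replicateW : ∀ n → countS (replicate n W) ≡ 0
countS-replicateW zero    = refl
countS-replicateW (suc n) = countS-replicateW n

countW-replicateW : ∀ n → countW (replicate n W) ≡ n
countW-replicateW zero    = refl
countW-replicateW (suc n) = cong suc (countW-replicateW n)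

-- Ranks along a prefix

restSteps : List ℕ → List Letter → List ℕ
restSteps ks       []      = ks
restSteps ks       (W ∷ u) = restSteps ks u
restSteps []       (S ∷ u) = restSteps [] u
restSteps (_ ∷ ks) (S ∷ u) = restSteps ks u

finalRank : List ℕ → ℤ → List Letter → ℤ
finalRank ks        r []      = r
finalRank ks        r (W ∷ u) = finalRank ks (r - + 1) u
finalRank []        r (S ∷ u) = finalRank [] r u
finalRank (kj ∷ ks) r (S ∷ u) = finalRank ks (r +ℤ + kj) u

ranksFrom-++ : ∀ ks r u v →
  ranksFrom ks r (u ++ v) ≡ ranksFrom ks r u ++ ranksFrom (restSteps ks u) (finalRank ks r u) v
ranksFrom-++ ks         r []      v = refl
ranksFrom-++ []         r (S ∷ u) v = cong (r ∷_) (ranksFrom-++ [] r u v)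
ranksFrom-++ (_ ∷ ks)   r (S ∷ u) v = cong (r ∷_) (ranksFrom-++ ks _ u v)
ranksFrom-++ []         r (W ∷ u) v = cong (r ∷_) (ranksFrom-++ [] _ u v)
ranksFrom-++ ks@(_ ∷ _) r (W ∷ u) v = cong (r ∷_) (ranksFrom-++ ks _ u v)

areaFrom-++ : ∀ ks r u v →
  areaFrom ks r (u ++ v) ≡ areaFrom ks r u +ℤ areaFrom (restSteps ks u) (finalRank ks r u) v
areaFrom-++ ks         r []      v = sym (ℤ.+-identityˡ _)
areaFrom-++ []         r (S ∷ u) v = trans (cong (r +ℤ_) (areaFrom-++ [] r u v)) (sym (ℤ.+-assoc r _ _))
areaFrom-++ (_ ∷ ks)   r (S ∷ u) v = trans (cong (r +ℤ_) (areaFrom-++ ks _ u v)) (sym (ℤ.+-assoc r _ _))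
areaFrom-++ []         r (W ∷ u) v = areaFrom-++ [] _ u v
areaFrom-++ ks@(_ ∷ _) r (W ∷ u) v = areaFrom-++ ks _ u v

finalRank-++ : ∀ ks r u v → finalRank ks r (u ++ v) ≡ finalRank (restSteps ks u) (finalRank ks r u) v
finalRank-++ ks       r []      v = refl
finalRank-++ ks       r (W ∷ u) v = finalRank-++ ks _ u v
finalRank-++ []       r (S ∷ u) v = finalRank-++ [] r u v
finalRank-++ (_ ∷ ks) r (S ∷ u) v = finalRank-++ ks _ u v

ranksFrom-[_] : ∀ l {ks r} → ranksFrom ks r [ l ] ≡ [ r ]
ranksFrom-[ S ] {[]}    = refl
ranksFrom-[ S ] {_ ∷ _} = refl
ranksFrom-[ W ] {[]}    = refl
ranksFrom-[ W ] {_ ∷ _} = refl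

ranksFrom-head : ∀ {P : ℤ → Set} ks r l v → All P (ranksFrom ks r (l ∷ v)) → P r
ranksFrom-head []      r S v (pr ∷ _) = pr
ranksFrom-head (_ ∷ _) r S v (pr ∷ _) = pr
ranksFrom-head []      r W v (pr ∷ _) = pr
ranksFrom-head (_ ∷ _) r W v (pr ∷ _) = pr

finalRank-nonneg : ∀ ks r u l v → All (0ℤ ≤ℤ_) (ranksFrom ks r (u ++ l ∷ v)) → 0ℤ ≤ℤ finalRank ks r u
finalRank-nonneg ks r u l v nonneg = ranksFrom-head (restSteps ks u) _ l v
  (++⁻ʳ (ranksFrom ks r u) (subst (All (0ℤ ≤ℤ_)) (ranksFrom-++ ks r u (l ∷ v)) nonneg))

ranksFrom-extend : ∀ ks e r u → countS u ≤ length ks → ranksFrom (ks ++ e) r u ≡ ranksFrom ks r u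
ranksFrom-extend ks         e         r []      _         = refl
ranksFrom-extend (_ ∷ ks)   e         r (S ∷ u) (s≤s cS≤) = cong (r ∷_) (ranksFrom-extend ks e _ u cS≤)
ranksFrom-extend []         []        r (W ∷ u) cS≤       = cong (r ∷_) (ranksFrom-extend [] [] _ u cS≤)
ranksFrom-extend []         e@(_ ∷ _) r (W ∷ u) cS≤       = cong (r ∷_) (ranksFrom-extend [] e _ u cS≤)
ranksFrom-extend ks@(_ ∷ _) e         r (W ∷ u) cS≤       = cong (r ∷_) (ranksFrom-extend ks e _ u cS≤)

areaFrom-extend : ∀ ks e r u → countS u ≤ length ks → areaFrom (ks ++ e) r u ≡ areaFrom ks r u
areaFrom-extend ks         e         r []      _         = refl
areaFrom-extend (_ ∷ ks)   e         r (S ∷ u) (s≤s cS≤) = cong (r +ℤ_) (areaFrom-extend ks e _ u cS≤)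
areaFrom-extend []         []        r (W ∷ u) cS≤       = areaFrom-extend [] [] _ u cS≤
areaFrom-extend []         e@(_ ∷ _) r (W ∷ u) cS≤       = areaFrom-extend [] e _ u cS≤
areaFrom-extend ks@(_ ∷ _) e         r (W ∷ u) cS≤       = areaFrom-extend ks e _ u cS≤

finalRank-extend : ∀ ks e r u → countS u ≤ length ks → finalRank (ks ++ e) r u ≡ finalRank ks r u
finalRank-extend ks       e r []      _         = refl
finalRank-extend ks       e r (W ∷ u) cS≤       = finalRank-extend ks e _ u cS≤
finalRank-extend (_ ∷ ks) e r (S ∷ u) (s≤s cS≤) = finalRank-extend ks e _ u cS≤

restSteps-extend : ∀ ks e u → countS u ≤ length ks → restSteps (ks ++ e) u ≡ restSteps ks u ++ e
restSteps-extend ks       e []      _         = refl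
restSteps-extend ks       e (W ∷ u) cS≤       = restSteps-extend ks e u cS≤
restSteps-extend (_ ∷ ks) e (S ∷ u) (s≤s cS≤) = restSteps-extend ks e u cS≤

restSteps-exhausted : ∀ ks u → countS u ≡ length ks → restSteps ks u ≡ []
restSteps-exhausted []       []      _  = refl
restSteps-exhausted ks       (W ∷ u) eq = restSteps-exhausted ks u eq
restSteps-exhausted (_ ∷ ks) (S ∷ u) eq = restSteps-exhausted ks u (suc-injective eq)

restSteps-remaining : ∀ ks u → countS u < length ks → ∃₂ λ kj rest → restSteps ks u ≡ kj ∷ rest
restSteps-remaining (kj ∷ ks) []      _         = kj , ks , refl
restSteps-remaining ks        (W ∷ u) cS<       = restSteps-remaining ks u cS<
restSteps-remaining (_ ∷ ks)  (S ∷ u) (s≤s cS<) = restSteps-remaining ks u cS<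

finalRank-conservation : ∀ ks r u →
  finalRank ks r u +ℤ + (countW u + sum (restSteps ks u)) ≡ r +ℤ + sum ks
finalRank-conservation ks r [] = refl
finalRank-conservation ks r (W ∷ u) = begin
  F +ℤ + (1 + m)     ≡⟨ cong (F +ℤ_) (ℤ.pos-+ 1 m) ⟩
  F +ℤ (+ 1 +ℤ + m)  ≡⟨ shift-one F (+ m) ⟩
  F +ℤ + m +ℤ + 1     ≡⟨ cong (_+ℤ + 1) (finalRank-conservation ks (r - + 1) u) ⟩
  r - + 1 +ℤ + sum ks +ℤ + 1 ≡⟨ cancel-one r (+ sum ks) ⟩
  r +ℤ + sum ks ∎
  where
  open ≡-Reasoning
  F : ℤ
  F = finalRank ks (r - + 1) u
  m : ℕ
  m = countW u + sum (restSteps ks u)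
  shift-one : ∀ a b → a +ℤ (+ 1 +ℤ b) ≡ a +ℤ b +ℤ + 1
  shift-one = ℤ-solve-∀
  cancel-one : ∀ a b → a - + 1 +ℤ b +ℤ + 1 ≡ a +ℤ b
  cancel-one = ℤ-solve-∀
finalRank-conservation []        r (S ∷ u) = finalRank-conservation [] r u
finalRank-conservation (kj ∷ ks) r (S ∷ u) = begin
  finalRank ks (r +ℤ + kj) u +ℤ + (countW u + sum (restSteps ks u))
    ≡⟨ finalRank-conservation ks (r +ℤ + kj) u ⟩
  r +ℤ + kj +ℤ + sum ks ≡⟨ ℤ.+-assoc r (+ kj) (+ sum ks) ⟩
  r +ℤ (+ kj +ℤ + sum ks) ≡⟨ cong (r +ℤ_) (sym (ℤ.pos-+ kj (sum ks))) ⟩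
  r +ℤ + (kj + sum ks) ∎
  where open ≡-Reasoning

-- Valid prefixes

record ValidPrefix (ks : List ℕ) (u : List Letter) : Set where
  field
    ranks-nonneg     : All (0ℤ ≤ℤ_) (ranksFrom ks 0ℤ u)
    countS≤length    : countS u ≤ length ks
    height           : ℕ
    finalRank≡height : finalRank ks 0ℤ u ≡ + height

open ValidPrefix

module _ {ks : List ℕ} where

  validPrefix-[] : ValidPrefix ks []
  validPrefix-[] = record { ranks-nonneg = [] ; countS≤length = z≤n ; height = 0 ; finalRank≡height = refl }

  ¬validPrefix-W∷ : ∀ {u} → ¬ ValidPrefix ks (W ∷ u)
  ¬validPrefix-W∷ {[]}    p with finalRank≡height p
  ... | ()
  ¬validPrefix-W∷ {l ∷ v} p with finalRank-nonneg ks 0ℤ [ W ] l v (ranks-nonneg p)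
  ... | ()

  module _ {u : List Letter} (p : ValidPrefix ks u) where

    ranks-nonneg-snoc : ∀ l → All (0ℤ ≤ℤ_) (ranksFrom ks 0ℤ (u ++ [ l ]))
    ranks-nonneg-snoc l = subst (All (0ℤ ≤ℤ_)) (sym ranks-snoc)
      (++⁺ (ranks-nonneg p) (subst (0ℤ ≤ℤ_) (sym (finalRank≡height p)) (+≤+ z≤n) ∷ []))
      where
      ranks-snoc : ranksFrom ks 0ℤ (u ++ [ l ]) ≡ ranksFrom ks 0ℤ u ++ [ finalRank ks 0ℤ u ]
      ranks-snoc = trans (ranksFrom-++ ks 0ℤ u [ l ]) (cong (ranksFrom ks 0ℤ u ++_) ranksFrom-[ l ])

    validPrefix-S : countS u < length ks → ValidPrefix ks (u ++ [ S ])
    validPrefix-S cS< with restSteps-remaining ks u cS<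
    ... | kj , _ , rest≡ = record
      { ranks-nonneg     = ranks-nonneg-snoc S
      ; countS≤length    = subst (_≤ length ks) (sym (trans (countS-++ u [ S ]) (+-comm _ 1))) cS<
      ; height           = height p + kj
      ; finalRank≡height = begin
          finalRank ks 0ℤ (u ++ [ S ])
            ≡⟨ finalRank-++ ks 0ℤ u [ S ] ⟩
          finalRank (restSteps ks u) (finalRank ks 0ℤ u) [ S ]
            ≡⟨ cong₂ (λ ks′ r → finalRank ks′ r [ S ]) rest≡ (finalRank≡height p) ⟩
          + height p +ℤ + kj
            ≡⟨ sym (ℤ.pos-+ (height p) kj) ⟩
          + (height p + kj) ∎
      }
      where open ≡-Reasoning

    validPrefix-W : ∀ {h} → height p ≡ suc h → ValidPrefix ks (u ++ [ W ])
    validPrefix-W {h} h≡ = record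
      { ranks-nonneg     = ranks-nonneg-snoc W
      ; countS≤length    = subst (_≤ length ks) (sym (trans (countS-++ u [ W ]) (+-identityʳ _))) (countS≤length p)
      ; height           = h
      ; finalRank≡height = trans (finalRank-++ ks 0ℤ u [ W ])
                                 (cong (_- + 1) (trans (finalRank≡height p) (cong +_ h≡)))
      }

    height-conservation : height p + (countW u + sum (restSteps ks u)) ≡ sum ks
    height-conservation = ℤ.+-injective (begin
      + (height p + X)         ≡⟨ ℤ.pos-+ (height p) X ⟩
      + height p +ℤ + X        ≡⟨ cong (_+ℤ + X) (sym (finalRank≡height p)) ⟩
      finalRank ks 0ℤ u +ℤ + X ≡⟨ finalRank-conservation ks 0ℤ u ⟩
      + sum ks ∎)
      where
      open ≡-Reasoning
      X : ℕ
      X = countW u + sum (restSteps ks u)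

    countW≤sum : countW u ≤ sum ks
    countW≤sum = ≤-trans (m≤m+n (countW u) _) (≤-trans (m≤n+m _ (height p)) (≤-reflexive height-conservation))

lenN-snoc : ∀ as x → lenN (as ++ [ x ]) ≡ suc (length as + sum as + x)
lenN-snoc as x = trans (cong₂ _+_ (sum-++ as [ x ]) (length-++ as)) (rearrange (sum as) x (length as))
  where
  rearrange : ∀ s x l → s + (x + 0) + (l + 1) ≡ suc (l + s + x)
  rearrange = ℕ-solve-∀

length<lenN : ∀ {as u} x → ValidPrefix as u → length u < lenN (as ++ [ x ])
length<lenN {as} {u} x p = begin-strict
  length u                     ≡⟨ length≡countS+countW u ⟩
  countS u + countW u          ≤⟨ +-mono-≤ (countS≤length p) (countW≤sum p) ⟩
  length as + sum as           <⟨ s≤s (m≤m+n _ x) ⟩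
  suc (length as + sum as + x) ≡⟨ lenN-snoc as x ⟨
  lenN (as ++ [ x ]) ∎
  where open ≤-Reasoning

-- The filling algorithm

emptyColumns : List Column → ℕ
emptyColumns []                = 0
emptyColumns ((_ , []) ∷ T)    = suc (emptyColumns T)
emptyColumns ((_ , _ ∷ _) ∷ T) = emptyColumns T

emptyColumns-emptyTableau : ∀ ks → emptyColumns (emptyTableau ks) ≡ length ks
emptyColumns-emptyTableau []       = refl
emptyColumns-emptyTableau (_ ∷ ks) = cong suc (emptyColumns-emptyTableau ks)

module _ (i : ℕ) where

  placeTop-++ : ∀ A Z → 0 < emptyColumns A → placeTop i (A ++ Z) ≡ placeTop i A ++ Z
  placeTop-++ ((c , [])     ∷ A) Z _  = refl
  placeTop-++ ((c , x ∷ xs) ∷ A) Z 0< = cong ((c , x ∷ xs) ∷_) (placeTop-++ A Z 0<)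

  placeTop-++-full : ∀ A Z → emptyColumns A ≡ 0 → placeTop i (A ++ Z) ≡ A ++ placeTop i Z
  placeTop-++-full []                 Z _    = refl
  placeTop-++-full ((c , x ∷ xs) ∷ A) Z full = cong ((c , x ∷ xs) ∷_) (placeTop-++-full A Z full)

  emptyColumns-placeTop : ∀ A → 0 < emptyColumns A → suc (emptyColumns (placeTop i A)) ≡ emptyColumns A
  emptyColumns-placeTop ((c , [])     ∷ A) _  = refl
  emptyColumns-placeTop ((c , x ∷ xs) ∷ A) 0< = emptyColumns-placeTop A 0<

  putBelow-++-empty : ∀ e A c → putBelow e i (A ++ [ (c , []) ]) ≡ putBelow e i A ++ [ (c , []) ]
  putBelow-++-empty e []                  c = refl
  putBelow-++-empty e ((c′ , [])     ∷ A) c = cong ((c′ , []) ∷_) (putBelow-++-empty e A c)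
  putBelow-++-empty e ((c′ , x ∷ xs) ∷ A) c with lastOf x xs ≡ᵇ e
  ... | true  = refl
  ... | false = cong ((c′ , x ∷ xs) ∷_) (putBelow-++-empty e A c)

  emptyColumns-putBelow : ∀ e A → emptyColumns (putBelow e i A) ≡ emptyColumns A
  emptyColumns-putBelow e []                  = refl
  emptyColumns-putBelow e ((c′ , [])     ∷ A) = cong suc (emptyColumns-putBelow e A)
  emptyColumns-putBelow e ((c′ , x ∷ xs) ∷ A) with lastOf x xs ≡ᵇ e
  ... | true  = refl
  ... | false = emptyColumns-putBelow e A

maxActive-++-empty : ∀ A c → maxActive (A ++ [ (c , []) ]) ≡ maxActive A
maxActive-++-empty []        c = refl
maxActive-++-empty (col ∷ A) c = cong (maxM (activeOf col)) (maxActive-++-empty A c)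

step-W-++-empty : ∀ i A c → step i W (A ++ [ (c , []) ]) ≡ step i W A ++ [ (c , []) ]
step-W-++-empty i A c rewrite maxActive-++-empty A c with maxActive A
... | just e  = putBelow-++-empty i e A c
... | nothing = refl

emptyColumns-step-W : ∀ i A → emptyColumns (step i W A) ≡ emptyColumns A
emptyColumns-step-W i A with maxActive A
... | just e  = emptyColumns-putBelow i e A
... | nothing = refl

fillFrom-++ : ∀ i v w T → fillFrom i (v ++ w) T ≡ fillFrom (length v + i) w (fillFrom i v T)
fillFrom-++ i []      w T = refl
fillFrom-++ i (l ∷ v) w T =
  trans (fillFrom-++ (suc i) v w (step i l T))
        (cong (λ i′ → fillFrom i′ w (fillFrom (suc i) v (step i l T))) (+-suc (length v) i))

emptyColumns-placeTop-≤ : ∀ i A {n} → suc n ≤ emptyColumns A → n ≤ emptyColumns (placeTop i A)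
emptyColumns-placeTop-≤ i A n< =
  ≤-pred (≤-trans n< (≤-reflexive (sym (emptyColumns-placeTop i A (≤-trans (s≤s z≤n) n<)))))

fillFrom-++-empty : ∀ i v A c → countS v ≤ emptyColumns A →
  fillFrom i v (A ++ [ (c , []) ]) ≡ fillFrom i v A ++ [ (c , []) ]
fillFrom-++-empty i []      A c _   = refl
fillFrom-++-empty i (S ∷ v) A c cS≤ =
  trans (cong (fillFrom (suc i) v) (placeTop-++ i A _ (≤-trans (s≤s z≤n) cS≤)))
        (fillFrom-++-empty (suc i) v (placeTop i A) c (emptyColumns-placeTop-≤ i A cS≤))
fillFrom-++-empty i (W ∷ v) A c cS≤ =
  trans (cong (fillFrom (suc i) v) (step-W-++-empty i A c))
        (fillFrom-++-empty (suc i) v (step i W A) c (≤-trans cS≤ (≤-reflexive (sym (emptyColumns-step-W i A)))))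

emptyColumns-fillFrom : ∀ i v A → countS v ≤ emptyColumns A →
  emptyColumns (fillFrom i v A) + countS v ≡ emptyColumns A
emptyColumns-fillFrom i []      A _   = +-identityʳ _
emptyColumns-fillFrom i (S ∷ v) A cS≤ = begin
  emptyColumns (fillFrom (suc i) v (placeTop i A)) + suc (countS v)
    ≡⟨ +-suc _ (countS v) ⟩
  suc (emptyColumns (fillFrom (suc i) v (placeTop i A)) + countS v)
    ≡⟨ cong suc (emptyColumns-fillFrom (suc i) v (placeTop i A) (emptyColumns-placeTop-≤ i A cS≤)) ⟩
  suc (emptyColumns (placeTop i A))
    ≡⟨ emptyColumns-placeTop i A (≤-trans (s≤s z≤n) cS≤) ⟩
  emptyColumns A ∎
  where open ≡-Reasoning
emptyColumns-fillFrom i (W ∷ v) A cS≤ =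
  trans (emptyColumns-fillFrom (suc i) v (step i W A) (≤-trans cS≤ (≤-reflexive (sym (emptyColumns-step-W i A)))))
        (emptyColumns-step-W i A)

Bounded : ℕ → List Column → Set
Bounded i = All (All (_< i) ∘ proj₂)

module _ {i : ℕ} where

  Bounded-suc : ∀ {T} → Bounded i T → Bounded (suc i) T
  Bounded-suc = All.map (All.map m<n⇒m<1+n)

  Bounded-emptyTableau : ∀ ks → Bounded i (emptyTableau ks)
  Bounded-emptyTableau []       = []
  Bounded-emptyTableau (_ ∷ ks) = [] ∷ Bounded-emptyTableau ks

  Bounded-placeTop : ∀ A → Bounded i A → Bounded (suc i) (placeTop i A)
  Bounded-placeTop []                 []       = []
  Bounded-placeTop ((c , [])     ∷ A) (_ ∷ bA) = (n<1+n i ∷ []) ∷ Bounded-suc bA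
  Bounded-placeTop ((c , x ∷ xs) ∷ A) (b ∷ bA) = All.map m<n⇒m<1+n b ∷ Bounded-placeTop A bA

  Bounded-putBelow : ∀ e A → Bounded i A → Bounded (suc i) (putBelow e i A)
  Bounded-putBelow e []                 []       = []
  Bounded-putBelow e ((c , [])     ∷ A) (_ ∷ bA) = [] ∷ Bounded-putBelow e A bA
  Bounded-putBelow e ((c , x ∷ xs) ∷ A) (b ∷ bA) with lastOf x xs ≡ᵇ e
  ... | true  = ++⁺ (All.map m<n⇒m<1+n b) (n<1+n i ∷ []) ∷ Bounded-suc bA
  ... | false = All.map m<n⇒m<1+n b ∷ Bounded-putBelow e A bA

  Bounded-step : ∀ l A → Bounded i A → Bounded (suc i) (step i l A)
  Bounded-step S A bA = Bounded-placeTop A bA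
  Bounded-step W A bA with maxActive A
  ... | just e  = Bounded-putBelow e A bA
  ... | nothing = Bounded-suc bA

Bounded-fillFrom : ∀ i v A → Bounded i A → Bounded (length v + i) (fillFrom i v A)
Bounded-fillFrom i []      A bA = bA
Bounded-fillFrom i (l ∷ v) A bA =
  subst (λ i′ → Bounded i′ (fillFrom (suc i) v (step i l A))) (+-suc (length v) i)
        (Bounded-fillFrom (suc i) v (step i l A) (Bounded-step l A bA))

-- Entries appended below

data _≼[_]_ : List ℕ → ℕ → List ℕ → Set where
  empty  : ∀ {p} → [] ≼[ p ] []
  append : ∀ {p x xs ys} → All (p <_) ys → (x ∷ xs) ≼[ p ] (x ∷ xs ++ ys)

_≼ᵀ[_]_ : List Column → ℕ → List Column → Set
T ≼ᵀ[ p ] T′ = Pointwise (λ col col′ → proj₂ col ≼[ p ] proj₂ col′) T T′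

≼-refl : ∀ {p} xs → xs ≼[ p ] xs
≼-refl []       = empty
≼-refl (x ∷ xs) = subst (λ ys → (x ∷ xs) ≼[ _ ] (x ∷ ys)) (++-identityʳ xs) (append [])

≼-snoc : ∀ {p i xs y ys} → xs ≼[ p ] (y ∷ ys) → p < i → xs ≼[ p ] (y ∷ ys ++ [ i ])
≼-snoc {p} {i} (append {x = x} {xs} {ys} big) p<i =
  subst (λ zs → (x ∷ xs) ≼[ p ] (x ∷ zs)) (sym (++-assoc xs ys [ i ])) (append (++⁺ big (p<i ∷ [])))

≼ᵀ-putBelow : ∀ {p T T′} e i → p < i → T ≼ᵀ[ p ] T′ → T ≼ᵀ[ p ] putBelow e i T′
≼ᵀ-putBelow e i p<i []                                 = []
≼ᵀ-putBelow e i p<i (_∷_ {y = (c , [])}     col cols) = col ∷ ≼ᵀ-putBelow e i p<i cols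
≼ᵀ-putBelow e i p<i (_∷_ {y = (c , y ∷ ys)} col cols) with lastOf y ys ≡ᵇ e
... | true  = ≼-snoc col p<i ∷ cols
... | false = col ∷ ≼ᵀ-putBelow e i p<i cols

≼ᵀ-fillFrom-W : ∀ {p T T′} n i → p < i → T ≼ᵀ[ p ] T′ → T ≼ᵀ[ p ] fillFrom i (replicate n W) T′
≼ᵀ-fillFrom-W                 zero    i p<i ext = ext
≼ᵀ-fillFrom-W {p} {T} {T′} (suc n) i p<i ext = ≼ᵀ-fillFrom-W n (suc i) (m<n⇒m<1+n p<i) ≼ᵀ-step
  where
  ≼ᵀ-step : T ≼ᵀ[ p ] step i W T′
  ≼ᵀ-step with maxActive T′
  ... | just e  = ≼ᵀ-putBelow e i p<i ext
  ... | nothing = ext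

keepUpTo : ℕ → List (ℕ × ℕ) → List (ℕ × ℕ)
keepUpTo p = filter ((_≤? p) ∘ proj₁)

lookupRank-keepUpTo : ∀ {a p} acc → a ≤ p → lookupRank a acc ≡ lookupRank a (keepUpTo p acc)
lookupRank-keepUpTo                 []              _   = refl
lookupRank-keepUpTo {a} {p} ((e , r) ∷ acc) a≤p with e ≤? p
... | yes e≤p = trans (cong (if e ≡ᵇ a then r else_) (lookupRank-keepUpTo acc a≤p))
                      (cong (lookupRank a) (sym (filter-accept ((_≤? p) ∘ proj₁) e≤p)))
... | no e≰p  = trans (cong (if_then r else lookupRank a acc) e≢a)
                      (trans (lookupRank-keepUpTo acc a≤p)
                             (cong (lookupRank a) (sym (filter-reject ((_≤? p) ∘ proj₁) e≰p))))
  where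
  e≢a : (e ≡ᵇ a) ≡ false
  e≢a = dec-false (e ≟ a) (λ { refl → e≰p a≤p })

keepUpTo-rankColumn-++ : ∀ {p} α xs {ys} → All (p <_) ys →
  keepUpTo p (rankColumn α (xs ++ ys)) ≡ keepUpTo p (rankColumn α xs)
keepUpTo-rankColumn-++     α []       []            = refl
keepUpTo-rankColumn-++ {p} α []       (p<y ∷ big) =
  trans (filter-reject ((_≤? p) ∘ proj₁) (<⇒≱ p<y)) (keepUpTo-rankColumn-++ (suc α) [] big)
keepUpTo-rankColumn-++ {p} α (x ∷ xs) big with x ≤? p
... | yes x≤p = trans (filter-accept ((_≤? p) ∘ proj₁) x≤p)
                      (trans (cong ((x , α) ∷_) (keepUpTo-rankColumn-++ (suc α) xs big))
                             (sym (filter-accept ((_≤? p) ∘ proj₁) x≤p)))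
... | no x≰p  = trans (filter-reject ((_≤? p) ∘ proj₁) x≰p)
                      (trans (keepUpTo-rankColumn-++ (suc α) xs big)
                             (sym (filter-reject ((_≤? p) ∘ proj₁) x≰p)))

keepUpTo-rankColumn-≼ : ∀ {p xs xs′} α → xs ≼[ p ] xs′ →
  keepUpTo p (rankColumn α xs′) ≡ keepUpTo p (rankColumn α xs)
keepUpTo-rankColumn-≼ α empty                         = refl
keepUpTo-rankColumn-≼ α (append {x = x} {xs} big) = keepUpTo-rankColumn-++ α (x ∷ xs) big

topRank-≼ : ∀ {p acc acc′ xs xs′} → keepUpTo p acc ≡ keepUpTo p acc′ → All (_< suc p) xs → xs ≼[ p ] xs′ →
  topRank acc xs ≡ topRank acc′ xs′
topRank-≼                     same _            empty                  = refl
topRank-≼ {p} {acc} {acc′} same (x<1+p ∷ _) (append {x = x} _) = begin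
  lookupRank (x ∸ 1) acc                ≡⟨ lookupRank-keepUpTo acc a≤p ⟩
  lookupRank (x ∸ 1) (keepUpTo p acc)   ≡⟨ cong (lookupRank (x ∸ 1)) same ⟩
  lookupRank (x ∸ 1) (keepUpTo p acc′)  ≡⟨ lookupRank-keepUpTo acc′ a≤p ⟨
  lookupRank (x ∸ 1) acc′ ∎
  where
  open ≡-Reasoning
  a≤p : x ∸ 1 ≤ p
  a≤p = ≤-trans (m∸n≤m x 1) (≤-pred x<1+p)

depthRest-≼ᵀ : ∀ {p acc acc′ T T′} → keepUpTo p acc ≡ keepUpTo p acc′ → Bounded (suc p) T → T ≼ᵀ[ p ] T′ →
  depthRest acc T ≡ depthRest acc′ T′
depthRest-≼ᵀ same [] [] = refl
depthRest-≼ᵀ {p} {acc} {acc′} same (b ∷ bT) (_∷_ {x = (_ , xs)} {y = (_ , xs′)} col cols) =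
  cong₂ _+_ top≡ (depthRest-≼ᵀ same′ bT cols)
  where
  open ≡-Reasoning
  top≡ : topRank acc xs ≡ topRank acc′ xs′
  top≡ = topRank-≼ same b col
  same′ : keepUpTo p (acc ++ rankColumn (topRank acc xs) xs)
        ≡ keepUpTo p (acc′ ++ rankColumn (topRank acc′ xs′) xs′)
  same′ = begin
    keepUpTo p (acc ++ rankColumn (topRank acc xs) xs)
      ≡⟨ filter-++ _ acc _ ⟩
    keepUpTo p acc ++ keepUpTo p (rankColumn (topRank acc xs) xs)
      ≡⟨ cong₂ (λ ks α → ks ++ keepUpTo p (rankColumn α xs)) same top≡ ⟩
    keepUpTo p acc′ ++ keepUpTo p (rankColumn (topRank acc′ xs′) xs)
      ≡⟨ cong (keepUpTo p acc′ ++_) (keepUpTo-rankColumn-≼ _ col) ⟨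
    keepUpTo p acc′ ++ keepUpTo p (rankColumn (topRank acc′ xs′) xs′)
      ≡⟨ filter-++ _ acc′ _ ⟨
    keepUpTo p (acc′ ++ rankColumn (topRank acc′ xs′) xs′) ∎

-- Entries above p are never the predecessor A of a top entry A + 1 ≤ p + 1, so no first-row rank sees them.
depthTab-≼ᵀ : ∀ {p T T′} → Bounded (suc p) T → T ≼ᵀ[ p ] T′ → depthTab T ≡ depthTab T′
depthTab-≼ᵀ []       []         = refl
depthTab-≼ᵀ (_ ∷ bT) (col ∷ cols) = depthRest-≼ᵀ (sym (keepUpTo-rankColumn-≼ 0 col)) bT cols

-- Paths ending in S W⋯W

Bounded-fill : ∀ ks u → Bounded (2 + length u) (fill ks u)
Bounded-fill ks []      = Bounded-placeTop (emptyTableau ks) (Bounded-emptyTableau ks)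
Bounded-fill ks (_ ∷ u) =
  Bounded-suc (subst (λ i → Bounded i (fillFrom 2 u P)) (+-comm (length u) 2)
                     (Bounded-fillFrom 2 u P (Bounded-placeTop (emptyTableau ks) (Bounded-emptyTableau ks))))
  where
  P : List Column
  P = placeTop 1 (emptyTableau ks)

areaFrom-replicateW : ∀ r n → areaFrom [] r (replicate n W) ≡ 0ℤ
areaFrom-replicateW r zero    = refl
areaFrom-replicateW r (suc n) = areaFrom-replicateW _ n

ranksFrom-replicateW-nonneg : ∀ n → All (0ℤ ≤ℤ_) (ranksFrom [] (+ n) (replicate n W))
ranksFrom-replicateW-nonneg zero    = []
ranksFrom-replicateW-nonneg (suc n) = +≤+ z≤n ∷ ranksFrom-replicateW-nonneg n

completionArea : List ℕ → List Letter → ℤ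
completionArea as u = areaFrom as 0ℤ u +ℤ finalRank as 0ℤ u

-- depthTab ignores capacities, so the capacity 0 of the last column is a dummy.
completionDepth : List ℕ → List Letter → ℕ
completionDepth as u = depthTab (fill as u ++ [ (0 , [ suc (length u) ]) ])

fill-last : ∀ {as u} x n → ValidPrefix as u → countS u ≡ length as →
  fill (as ++ [ x ]) (u ++ S ∷ replicate n W)
    ≡ fillFrom (2 + length u) (replicate n W) (fill as u ++ [ (suc x , [ suc (length u) ]) ])
fill-last {[]}    {[]}         x n _ _   = refl
fill-last         {u = W ∷ _}  x n p _   = ⊥-elim (¬validPrefix-W∷ p)
fill-last {as}    {S ∷ u₀}     x n _ cS≡ = begin
  fillFrom 2 (u₀ ++ S ∷ replicate n W) (placeTop 1 (emptyTableau (as ++ [ x ])))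
    ≡⟨ cong (λ T → fillFrom 2 (u₀ ++ S ∷ replicate n W) (placeTop 1 T)) (map-++ _ as [ x ]) ⟩
  fillFrom 2 (u₀ ++ S ∷ replicate n W) (placeTop 1 (emptyTableau as ++ [ Z ]))
    ≡⟨ cong (fillFrom 2 (u₀ ++ S ∷ replicate n W))
            (placeTop-++ 1 (emptyTableau as) [ Z ] (≤-trans (s≤s z≤n) L≤)) ⟩
  fillFrom 2 (u₀ ++ S ∷ replicate n W) (P ++ [ Z ])
    ≡⟨ fillFrom-++ 2 u₀ (S ∷ replicate n W) (P ++ [ Z ]) ⟩
  fillFrom (length u₀ + 2) (S ∷ replicate n W) (fillFrom 2 u₀ (P ++ [ Z ]))
    ≡⟨ cong₂ (λ i T → fillFrom i (S ∷ replicate n W) T) (+-comm (length u₀) 2)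
             (fillFrom-++-empty 2 u₀ P (suc x) (≤-reflexive (sym emptyP))) ⟩
  fillFrom (suc q) (replicate n W) (placeTop q (A ++ [ Z ]))
    ≡⟨ cong (fillFrom (suc q) (replicate n W)) (placeTop-++-full q A [ Z ] fullA) ⟩
  fillFrom (suc q) (replicate n W) (A ++ [ (suc x , [ q ]) ]) ∎
  where
  open ≡-Reasoning
  Z : Column
  Z = (suc x , [])
  P A : List Column
  P = placeTop 1 (emptyTableau as)
  A = fillFrom 2 u₀ P
  q : ℕ
  q = 2 + length u₀
  L≤ : suc (countS u₀) ≤ emptyColumns (emptyTableau as)
  L≤ = ≤-reflexive (trans cS≡ (sym (emptyColumns-emptyTableau as)))
  emptyP : emptyColumns P ≡ countS u₀
  emptyP = suc-injective (trans (emptyColumns-placeTop 1 (emptyTableau as) (≤-trans (s≤s z≤n) L≤))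
                                (trans (emptyColumns-emptyTableau as) (sym cS≡)))
  fullA : emptyColumns A ≡ 0
  fullA = +-cancelʳ-≡ (countS u₀) (emptyColumns A) 0
                      (trans (emptyColumns-fillFrom 2 u₀ P (≤-reflexive (sym emptyP))) emptyP)

module _ {as : List ℕ} (x : ℕ) {u : List Letter} (cS≡ : countS u ≡ length as) where

  private
    cS≤ : countS u ≤ length as
    cS≤ = ≤-reflexive cS≡

  restSteps-last : restSteps (as ++ [ x ]) u ≡ [ x ]
  restSteps-last = trans (restSteps-extend as [ x ] u cS≤) (cong (_++ [ x ]) (restSteps-exhausted as u cS≡))

  area-last : ∀ n → area (as ++ [ x ]) (u ++ S ∷ replicate n W) ≡ completionArea as u
  area-last n = begin
    areaFrom (as ++ [ x ]) 0ℤ (u ++ S ∷ replicate n W)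
      ≡⟨ areaFrom-++ (as ++ [ x ]) 0ℤ u _ ⟩
    areaFrom (as ++ [ x ]) 0ℤ u
      +ℤ areaFrom (restSteps (as ++ [ x ]) u) (finalRank (as ++ [ x ]) 0ℤ u) (S ∷ replicate n W)
      ≡⟨ cong₂ _+ℤ_ (areaFrom-extend as [ x ] 0ℤ u cS≤)
                    (cong₂ (λ ks r → areaFrom ks r (S ∷ replicate n W))
                           restSteps-last (finalRank-extend as [ x ] 0ℤ u cS≤)) ⟩
    areaFrom as 0ℤ u +ℤ (finalRank as 0ℤ u +ℤ areaFrom [] _ (replicate n W))
      ≡⟨ cong (λ a → areaFrom as 0ℤ u +ℤ (finalRank as 0ℤ u +ℤ a)) (areaFrom-replicateW _ n) ⟩
    areaFrom as 0ℤ u +ℤ (finalRank as 0ℤ u +ℤ 0ℤ)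
      ≡⟨ cong (areaFrom as 0ℤ u +ℤ_) (ℤ.+-identityʳ _) ⟩
    completionArea as u ∎
    where open ≡-Reasoning

  module _ (p : ValidPrefix as u) where

    depth-last : ∀ n → depth (as ++ [ x ]) (u ++ S ∷ replicate n W) ≡ completionDepth as u
    depth-last n = begin
      depthTab (fill (as ++ [ x ]) (u ++ S ∷ replicate n W))
        ≡⟨ cong depthTab (fill-last x n p cS≡) ⟩
      depthTab (fillFrom (suc q) (replicate n W) (fill as u ++ [ (suc x , [ q ]) ]))
        ≡⟨ depthTab-≼ᵀ bounded (≼ᵀ-fillFrom-W n (suc q) (n<1+n q) capacity-change) ⟨
      completionDepth as u ∎
      where
      open ≡-Reasoning
      q : ℕ
      q = suc (length u)
      bounded : Bounded (suc q) (fill as u ++ [ (0 , [ q ]) ])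
      bounded = ++⁺ (Bounded-fill as u) ((n<1+n q ∷ []) ∷ [])
      capacity-change : (fill as u ++ [ (0 , [ q ]) ]) ≼ᵀ[ q ] (fill as u ++ [ (suc x , [ q ]) ])
      capacity-change = Pointwise.++⁺ (Pointwise.refl (≼-refl _)) (≼-refl [ q ] ∷ [])

    height-last : ∀ {n} → suc n + length u ≡ lenN (as ++ [ x ]) → n ≡ height p + x
    height-last {n} len≡ = +-cancelʳ-≡ (length as + countW u) n (height p + x) (begin
      n + (length as + countW u)
        ≡⟨ suc-injective (trans (cong (λ l → suc n + l) (sym length-u)) (trans len≡ (lenN-snoc as x))) ⟩
      length as + sum as + x
        ≡⟨ cong (λ s → length as + s + x) (sym conservation) ⟩
      length as + (height p + (countW u + 0)) + x
        ≡⟨ rearrange (length as) (height p) (countW u) x ⟩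
      height p + x + (length as + countW u) ∎)
      where
      open ≡-Reasoning
      length-u : length u ≡ length as + countW u
      length-u = trans (length≡countS+countW u) (cong (_+ countW u) cS≡)
      conservation : height p + (countW u + 0) ≡ sum as
      conservation = trans (cong (λ ks → height p + (countW u + sum ks)) (sym (restSteps-exhausted as u cS≡)))
                           (height-conservation p)
      rearrange : ∀ l h w x → l + (h + (w + 0)) + x ≡ h + x + (l + w)
      rearrange = ℕ-solve-∀

    countS-last : ∀ n → countS (u ++ S ∷ replicate n W) ≡ length (as ++ [ x ])
    countS-last n = begin
      countS (u ++ S ∷ replicate n W)         ≡⟨ countS-++ u _ ⟩
      countS u + suc (countS (replicate n W)) ≡⟨ cong₂ (λ a b → a + suc b) cS≡ (countS-replicateW n) ⟩
      length as + 1                           ≡⟨ length-++ as ⟨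
      length (as ++ [ x ]) ∎
      where open ≡-Reasoning

    countW-last : ∀ {n} → n ≡ height p + x → countW (u ++ S ∷ replicate n W) ≡ sum (as ++ [ x ])
    countW-last {n} n≡ = begin
      countW (u ++ S ∷ replicate n W)                        ≡⟨ countW-++ u _ ⟩
      countW u + countW (replicate n W)                      ≡⟨ cong (λ m → countW u + m)
                                                                     (trans (countW-replicateW n) n≡) ⟩
      countW u + (height p + x)                              ≡⟨ rearrange (countW u) (height p) x ⟩
      height p + (countW u + sum []) + (x + 0)               ≡⟨ cong (λ ks → height p + (countW u + sum ks) + (x + 0))
                                                                     (restSteps-exhausted as u cS≡) ⟨
      height p + (countW u + sum (restSteps as u)) + (x + 0) ≡⟨ cong (_+ (x + 0)) (height-conservation p) ⟩
      sum as + (x + 0)                                       ≡⟨ sum-++ as [ x ] ⟨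
      sum (as ++ [ x ]) ∎
      where
      open ≡-Reasoning
      rearrange : ∀ w h x → w + (h + x) ≡ h + (w + 0) + (x + 0)
      rearrange = ℕ-solve-∀

    startRanks-last : ∀ n → startRanks (as ++ [ x ]) (u ++ S ∷ replicate n W)
                          ≡ ranksFrom as 0ℤ u ++ + height p ∷ ranksFrom [] (+ (height p + x)) (replicate n W)
    startRanks-last n = begin
      ranksFrom (as ++ [ x ]) 0ℤ (u ++ S ∷ replicate n W)
        ≡⟨ ranksFrom-++ (as ++ [ x ]) 0ℤ u _ ⟩
      ranksFrom (as ++ [ x ]) 0ℤ u
        ++ ranksFrom (restSteps (as ++ [ x ]) u) (finalRank (as ++ [ x ]) 0ℤ u) (S ∷ replicate n W)
        ≡⟨ cong₂ _++_ (ranksFrom-extend as [ x ] 0ℤ u cS≤)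
                      (cong₂ (λ ks r → ranksFrom ks r (S ∷ replicate n W)) restSteps-last
                             (trans (finalRank-extend as [ x ] 0ℤ u cS≤) (finalRank≡height p))) ⟩
      ranksFrom as 0ℤ u ++ ranksFrom [ x ] (+ height p) (S ∷ replicate n W) ∎
      where open ≡-Reasoning

    isKDyck-last : ∀ {n} → n ≡ height p + x → IsKDyck (as ++ [ x ]) (u ++ S ∷ replicate n W)
    isKDyck-last {n} refl = countS-last n , countW-last refl ,
      subst (All (0ℤ ≤ℤ_)) (sym (startRanks-last n))
            (++⁺ (ranks-nonneg p) (+≤+ z≤n ∷ ranksFrom-replicateW-nonneg n))

-- Counting completions of a prefix

Contributes : List ℕ → ℤ → ℕ → List Letter → Set
Contributes k i j = IsKDyck k ∩ (λ w → area k w ≡ i × depth k w ≡ j)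

contributes? : ∀ k i j → Decidable (Contributes k i j)
contributes? k i j = isKDyck? k ∩? (λ w → (area k w ≟ℤ i) ×-dec (depth k w ≟ j))

Ctilde≡countWords : ∀ k i j → Ctilde k i j ≡ countWords (contributes? k i j) (lenN k)
Ctilde≡countWords k i j = cong length (filter-filter _ (isKDyck? k) (words (lenN k)))

contributes-last⇔ : ∀ {as u i j} x n → ValidPrefix as u → countS u ≡ length as →
  suc n + length u ≡ lenN (as ++ [ x ]) →
  Contributes (as ++ [ x ]) i j (u ++ S ∷ replicate n W) ⇔ (completionArea as u ≡ i × completionDepth as u ≡ j)
contributes-last⇔ {as} {u} x n p cS≡ len≡ = mk⇔
  (λ (_ , area≡ , depth≡) → trans (sym area≡′) area≡ , trans (sym depth≡′) depth≡)
  (λ (area≡ , depth≡) → isKDyck-last x cS≡ p (height-last x cS≡ p len≡) , trans area≡′ area≡ , trans depth≡′ depth≡)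
  where
  area≡′ : area (as ++ [ x ]) (u ++ S ∷ replicate n W) ≡ completionArea as u
  area≡′ = area-last {as} x {u} cS≡ n
  depth≡′ : depth (as ++ [ x ]) (u ++ S ∷ replicate n W) ≡ completionDepth as u
  depth≡′ = depth-last x cS≡ p n

module _ (as : List ℕ) (i : ℤ) (j : ℕ) where

  completions : ℕ → List Letter → ℕ → ℕ
  completions x u = countWords (λ v → contributes? (as ++ [ x ]) i j (u ++ v))

  completionsVia : ℕ → List Letter → Letter → ℕ → ℕ
  completionsVia x u l = countWords (λ v → contributes? (as ++ [ x ]) i j (u ++ l ∷ v))

  completionsVia-last-S : ∀ {b c u n₁ n₂} → ValidPrefix as u → countS u ≡ length as →
    suc n₁ + length u ≡ lenN (as ++ [ b ]) → suc n₂ + length u ≡ lenN (as ++ [ c ]) →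
    completionsVia b u S n₁ ≡ completionsVia c u S n₂
  completionsVia-last-S {b} {c} {u} {n₁} {n₂} p cS≡ len₁ len₂ = begin
    completionsVia b u S n₁                          ≡⟨ countWords-onlyW (P? b) (onlyW b) n₁ ⟩
    length (filter (P? b) [ replicate n₁ W ])        ≡⟨ length-filter-singleton (P? b) (P? c) b⇔c ⟩
    length (filter (P? c) [ replicate n₂ W ])        ≡⟨ countWords-onlyW (P? c) (onlyW c) n₂ ⟨
    completionsVia c u S n₂ ∎
    where
    open ≡-Reasoning
    P? : ∀ x → Decidable (λ v → Contributes (as ++ [ x ]) i j (u ++ S ∷ v))
    P? x v = contributes? (as ++ [ x ]) i j (u ++ S ∷ v)
    b⇔c : Contributes (as ++ [ b ]) i j (u ++ S ∷ replicate n₁ W) ⇔ Contributes (as ++ [ c ]) i j (u ++ S ∷ replicate n₂ W)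
    b⇔c = ⇔-sym (contributes-last⇔ c n₂ p cS≡ len₂) ⇔-∘ contributes-last⇔ b n₁ p cS≡ len₁
    onlyW : ∀ x v → Contributes (as ++ [ x ]) i j (u ++ S ∷ v) → countS v ≡ 0
    onlyW x v ((cS≡′ , _) , _) = suc-injective (+-cancelˡ-≡ (length as) _ _ (begin
      length as + suc (countS v) ≡⟨ cong (_+ suc (countS v)) cS≡ ⟨
      countS u + suc (countS v)  ≡⟨ countS-++ u (S ∷ v) ⟨
      countS (u ++ S ∷ v)        ≡⟨ cS≡′ ⟩
      length (as ++ [ x ])       ≡⟨ length-++ as ⟩
      length as + 1 ∎))

  completionsVia-dead-end : ∀ x {u} → countS u ≤ length as → finalRank as 0ℤ u ≡ 0ℤ →
    ∀ n → completionsVia x u W n ≡ 0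
  completionsVia-dead-end x {u} cS≤ rank≡0 =
    countWords-none (λ v → contributes? (as ++ [ x ]) i j (u ++ W ∷ v)) ¬contributes
    where
    ¬contributes : ∀ v → ¬ Contributes (as ++ [ x ]) i j (u ++ W ∷ v)
    ¬contributes [] ((cS≡ , _) , _) = <⇒≱ (s≤s cS≤) (≤-reflexive (begin
      suc (length as)          ≡⟨ +-comm 1 (length as) ⟩
      length as + 1            ≡⟨ length-++ as ⟨
      length (as ++ [ x ])     ≡⟨ cS≡ ⟨
      countS (u ++ [ W ])      ≡⟨ countS-++ u [ W ] ⟩
      countS u + 0             ≡⟨ +-identityʳ _ ⟩
      countS u ∎))
      where open ≡-Reasoning
    ¬contributes (l ∷ v) ((_ , _ , ranks≥0) , _)
      with subst (0ℤ ≤ℤ_) rank≡-1 (finalRank-nonneg (as ++ [ x ]) 0ℤ (u ++ [ W ]) l v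
             (subst (All (0ℤ ≤ℤ_) ∘ ranksFrom (as ++ [ x ]) 0ℤ) (sym (++-assoc u [ W ] (l ∷ v))) ranks≥0))
      where
      rank≡-1 : finalRank (as ++ [ x ]) 0ℤ (u ++ [ W ]) ≡ 0ℤ - + 1
      rank≡-1 = trans (finalRank-++ (as ++ [ x ]) 0ℤ u [ W ])
                      (cong (_- + 1) (trans (finalRank-extend as [ x ] 0ℤ u cS≤) rank≡0))
    ... | ()

  completions-≡ : ∀ {b c} n₁ n₂ {u} → ValidPrefix as u →
    n₁ + length u ≡ lenN (as ++ [ b ]) → n₂ + length u ≡ lenN (as ++ [ c ]) →
    completions b u n₁ ≡ completions c u n₂
  completions-≡ {b}     zero     _        p len₁ _    = ⊥-elim (<⇒≢ (length<lenN b p) len₁)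
  completions-≡ {c = c} (suc _)  zero     p _    len₂ = ⊥-elim (<⇒≢ (length<lenN c p) len₂)
  completions-≡ {b} {c} (suc n₁) (suc n₂) {u} p len₁ len₂ = begin
    completions b u (suc n₁)                           ≡⟨ countWords-suc _ n₁ ⟩
    completionsVia b u S n₁ + completionsVia b u W n₁  ≡⟨ cong₂ _+_ S-branch W-branch ⟩
    completionsVia c u S n₂ + completionsVia c u W n₂  ≡⟨ countWords-suc _ n₂ ⟨
    completions c u (suc n₂) ∎
    where
    open ≡-Reasoning
    continue : ∀ l → ValidPrefix as (u ++ [ l ]) → completionsVia b u l n₁ ≡ completionsVia c u l n₂
    continue l p′ = begin
      completionsVia b u l n₁     ≡⟨ countWords-shift (contributes? (as ++ [ b ]) i j) u l n₁ ⟩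
      completions b (u ++ [ l ]) n₁ ≡⟨ completions-≡ n₁ n₂ p′ (length-snoc len₁) (length-snoc len₂) ⟩
      completions c (u ++ [ l ]) n₂ ≡⟨ countWords-shift (contributes? (as ++ [ c ]) i j) u l n₂ ⟨
      completionsVia c u l n₂ ∎
      where
      length-snoc : ∀ {n N} → suc n + length u ≡ N → n + length (u ++ [ l ]) ≡ N
      length-snoc {n} = trans (trans (cong (λ m → n + m) (trans (length-++ u) (+-comm (length u) 1)))
                                     (+-suc n (length u)))
    S-branch : completionsVia b u S n₁ ≡ completionsVia c u S n₂
    S-branch with m≤n⇒m<n∨m≡n (countS≤length p)
    ... | inj₁ cS< = continue S (validPrefix-S p cS<)
    ... | inj₂ cS≡ = completionsVia-last-S p cS≡ len₁ len₂
    W-branch : completionsVia b u W n₁ ≡ completionsVia c u W n₂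
    W-branch with height p in h≡
    ... | zero  = trans (completionsVia-dead-end b (countS≤length p) rank≡0 n₁)
                        (sym (completionsVia-dead-end c (countS≤length p) rank≡0 n₂))
      where
      rank≡0 : finalRank as 0ℤ u ≡ 0ℤ
      rank≡0 = trans (finalRank≡height p) (cong +_ h≡)
    ... | suc _ = continue W (validPrefix-W p h≡)

proposition5p3 : (as : List ℕ) (b c : ℕ) → All Positive as → Positive b → Positive c →
    (i : ℤ) (j : ℕ) → Ctilde (as ++ [ b ]) i j ≡ Ctilde (as ++ [ c ]) i j
proposition5p3 as b c _ _ _ i j = begin
  Ctilde (as ++ [ b ]) i j
    ≡⟨ Ctilde≡countWords (as ++ [ b ]) i j ⟩
  completions as i j b [] (lenN (as ++ [ b ]))
    ≡⟨ completions-≡ as i j _ _ validPrefix-[] (+-identityʳ _) (+-identityʳ _) ⟩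
  completions as i j c [] (lenN (as ++ [ c ]))
    ≡⟨ Ctilde≡countWords (as ++ [ c ]) i j ⟨
  Ctilde (as ++ [ c ]) i j ∎
  where open ≡-Reasoning
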